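{- Let $z$ be a variable. For all words $u, v \in \{z, z^{ - }\}^{*}$ (viewed as terms), the following are equivalent: $\mathsf{LANG}_{2} \models u = v$; $\mathsf{LANG} \models u = v$; $u = v$ (as words).
   Context: Terms over a set of variables $\mathbf{V}$ are generated by $t, s ::= x \mid \mathrm{I} \mid \bot \mid t \cdot s \mid t \cup s \mid t^{*} \mid x^{ - }$; a word $y_0\cdots y_{m-1}$ over $\{z, z^{ - }\}$ is viewed as the term $y_0 \cdot \ldots \cdot y_{m-1}$ (empty word as $\mathrm{I}$). For a set $X$, a language valuation over $X$ is a map $\mathfrak{v}$ from variables to subsets of $X^{*}$, extended to terms by $\hat{\mathfrak{v}}(\mathrm{I}) = \{\mathrm{I}\}$ (empty word), $\hat{\mathfrak{v}}(\bot) = \emptyset$, $\hat{\mathfrak{v}}(t\cdot s) = \{ab \mid a \in \hat{\mathfrak{v}}(t), b \in \hat{\mathfrak{v}}(s)\}$, $\hat{\mathfrak{v}}(t \cup s) = \hat{\mathfrak{v}}(t)\cup\hat{\mathfrak{v}}(s)$, $\hat{\mathfrak{v}}(t^{*}) = \hat{\mathfrak{v}}(t)^{*}$, $\hat{\mathfrak{v}}(x^{ - }) = X^{*} \setminus \mathfrak{v}(x)$. $\mathsf{LANG} \models t = s$ means $\hat{\mathfrak{v}}(t) = \hat{\mathfrak{v}}(s)$ for all language valuations over all sets $X$; $\mathsf{LANG}_{n} \models t = s$ means the same but only for language valuations over sets $X$ of cardinality at most $n$. -}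

module Defs where

open import Data.Nat using (ℕ)
open import Data.Fin using (Fin)
open import Data.List using (List; []; _∷_; _++_)
open import Data.Product using (Σ; ∃; _×_)
open import Relation.Nullary using (¬_)
open import Relation.Binary.PropositionalEquality using (_≡_)
open import Function.Definitions using (Injective)

data Term (V : Set) : Set where
  var  : V → Term V
  I    : Term V
  ⊥t   : Term V
  _·_  : Term V → Term V → Term V
  _∪_  : Term V → Term V → Term V
  _*   : Term V → Term V
  _⁻   : V → Term V

Lang : Set → Set₁
Lang X = List X → Set

_⊙_ : {X : Set} → Lang X → Lang X → Lang X
(L ⊙ M) w = Σ _ λ a → Σ _ λ b → (w ≡ a ++ b) × L a × M b

data Star {X : Set} (L : Lang X) : Lang X where
  ε-star : Star L []
  ·-star : ∀ {a b} → L a → Star L b → Star L (a ++ b)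

Valuation : Set → Set → Set₁
Valuation V X = V → Lang X

⟦_⟧ : {V X : Set} → Term V → Valuation V X → Lang X
⟦ var x ⟧ 𝔳 w = 𝔳 x w
⟦ I ⟧ 𝔳 w = w ≡ []
⟦ ⊥t ⟧ 𝔳 w = Data.Empty.⊥
  where import Data.Empty
⟦ t · s ⟧ 𝔳 = (⟦ t ⟧ 𝔳) ⊙ (⟦ s ⟧ 𝔳)
⟦ t ∪ s ⟧ 𝔳 w = Data.Sum._⊎_ (⟦ t ⟧ 𝔳 w) (⟦ s ⟧ 𝔳 w)
  where import Data.Sum
⟦ t * ⟧ 𝔳 = Star (⟦ t ⟧ 𝔳)
⟦ x ⁻ ⟧ 𝔳 w = ¬ (𝔳 x w)

_≐_ : {X : Set} → Lang X → Lang X → Set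
L ≐ M = ∀ w → (L w → M w) × (M w → L w)

LANG⊨ : {V : Set} → Term V → Term V → Set₁
LANG⊨ {V} t s = (X : Set) (𝔳 : Valuation V X) → ⟦ t ⟧ 𝔳 ≐ ⟦ s ⟧ 𝔳

CardLe : Set → ℕ → Set
CardLe X n = Σ (X → Fin n) λ f → Injective _≡_ _≡_ f

LANG[_]⊨ : {V : Set} → ℕ → Term V → Term V → Set₁
LANG[_]⊨ {V} n t s = (X : Set) → CardLe X n → (𝔳 : Valuation V X) → ⟦ t ⟧ 𝔳 ≐ ⟦ s ⟧ 𝔳

data Lit : Set where
  zl z⁻l : Lit

litTerm : {V : Set} → V → Lit → Term V
litTerm z zl = var z
litTerm z z⁻l = z ⁻

wordTerm : {V : Set} → V → List Lit → Term V
wordTerm z [] = I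
wordTerm z (y ∷ []) = litTerm z y
wordTerm z (y ∷ y' ∷ ys) = litTerm z y · wordTerm z (y' ∷ ys)

{-# OPTIONS --safe #-}
-- Let z denote {true} over the alphabet Bool, or alternatively the complement of {true}.
-- Each letter then denotes either exactly the word true or anything but it, and a word u
-- denotes the concatenations of such factors, among them the Bool word marks b u spelling u.
-- If u and v denote the same language, each spelling is matched by the other word.
-- Counting trues shows that the other word's non-true factors contain no true, so the two
-- spellings have the same gaps between consecutive trues nonempty. The two valuations thus
-- determine which gaps between z's and which gaps between z⁻'s are nonempty, and together
-- these determine the word.
module Submission where

open import Defs
open import Data.Bool.Base using (Bool; true; false; not; _≤_; b≤b)
import Data.Bool.Properties as Bool
open import Data.Fin.Base using (Fin)
open import Data.Fin.Properties using (2↔Bool)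
open import Data.List.Base using (List; []; _∷_; _++_; map)
open import Data.List.Properties using (≡-dec; ++-identityʳ; map-∘; map-cong; map-injective; ∷-injective)
open import Data.List.Relation.Binary.Pointwise as Pointwise
  using (Pointwise; _∷_; antisymmetric; Pointwise-≡⇒≡)
open import Data.Nat.Base using (ℕ; suc; _+_; z≤n; s≤s) renaming (_≤_ to _≤ℕ_)
open import Data.Nat.Properties using (≤-trans; m≤n+m; +-cancelʳ-≤; n≤0⇒n≡0)
open import Data.Product.Base using (_×_; _,_; proj₁; proj₂; uncurry)
open import Data.Product.Relation.Binary.Pointwise.NonDependent
  renaming (Pointwise to ×-Pointwise)
open import Function.Base using (_∘_)
open import Function.Bundles using (_⇔_; mk⇔; _↣_; Injection)
open import Function.Properties.Inverse using (↔⇒↣; ↔-sym)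
open import Relation.Nullary using (¬_)
open import Relation.Nullary.Decidable using (decidable-stable)
open import Relation.Binary.PropositionalEquality
  using (_≡_; refl; sym; trans; cong; cong₂; subst)

data Concat {A X : Set} (L : A → Lang X) : List A → Lang X where
  []  : Concat L [] []
  _∷_ : ∀ {a as w ws} → L a w → Concat L as ws → Concat L (a ∷ as) (w ++ ws)

Concat-map⁺ : {A B X : Set} {L : A → Lang X} {M : B → Lang X} {f : A → B} →
  (∀ a {w} → L a w → M (f a) w) → ∀ {u w} → Concat L u w → Concat M (map f u) w
Concat-map⁺ L⊆M []       = []
Concat-map⁺ L⊆M (x ∷ xs) = L⊆M _ x ∷ Concat-map⁺ L⊆M xs

Concat-map⁻ : {A B X : Set} {L : A → Lang X} {M : B → Lang X} {f : A → B} →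
  (∀ a {w} → M (f a) w → L a w) → ∀ u {w} → Concat M (map f u) w → Concat L u w
Concat-map⁻ M⊆L []      []       = []
Concat-map⁻ M⊆L (a ∷ u) (x ∷ xs) = M⊆L a x ∷ Concat-map⁻ M⊆L u xs

module _ {V X : Set} (z : V) (𝔳 : Valuation V X) where

  wordTerm⇒Concat : ∀ u {w} → ⟦ wordTerm z u ⟧ 𝔳 w → Concat (λ l → ⟦ litTerm z l ⟧ 𝔳) u w
  wordTerm⇒Concat []           refl = []
  wordTerm⇒Concat (l ∷ [])     {w} x = subst (Concat _ (l ∷ [])) (++-identityʳ w) (x ∷ [])
  wordTerm⇒Concat (l ∷ l′ ∷ u) (_ , _ , refl , x , xs) = x ∷ wordTerm⇒Concat (l′ ∷ u) xs

  Concat⇒wordTerm : ∀ u {w} → Concat (λ l → ⟦ litTerm z l ⟧ 𝔳) u w → ⟦ wordTerm z u ⟧ 𝔳 w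
  Concat⇒wordTerm []           []                 = refl
  Concat⇒wordTerm (l ∷ [])     (_∷_ {w = w} x []) =
    subst (⟦ litTerm z l ⟧ 𝔳) (sym (++-identityʳ w)) x
  Concat⇒wordTerm (l ∷ l′ ∷ u) (x ∷ xs)           = _ , _ , refl , x , Concat⇒wordTerm (l′ ∷ u) xs

Mark : Bool → Lang Bool
Mark true  w = w ≡ true ∷ []
Mark false w = ¬ (w ≡ true ∷ [])

Mark-self : ∀ p → Concat Mark p p
Mark-self []          = []
Mark-self (true ∷ p)  = refl ∷ Mark-self p
Mark-self (false ∷ p) = (λ ()) ∷ Mark-self p

trues : List Bool → ℕ
trues []          = 0
trues (true ∷ w)  = suc (trues w)
trues (false ∷ w) = trues w

trues-++ : ∀ x w → trues (x ++ w) ≡ trues x + trues w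
trues-++ []          w = refl
trues-++ (true ∷ x)  w = cong suc (trues-++ x w)
trues-++ (false ∷ x) w = trues-++ x w

Concat-Mark⇒trues-≤ : ∀ {p w} → Concat Mark p w → trues p ≤ℕ trues w
Concat-Mark⇒trues-≤ []                          = z≤n
Concat-Mark⇒trues-≤ (_∷_ {true} refl xs)        = s≤s (Concat-Mark⇒trues-≤ xs)
Concat-Mark⇒trues-≤ (_∷_ {false} {w = x} {ws} _ xs) rewrite trues-++ x ws =
  ≤-trans (Concat-Mark⇒trues-≤ xs) (m≤n+m (trues ws) (trues x))

-- The gap profile of w: the first component says whether w has a false before its
-- first true, and the list has one entry per true, saying whether a false follows it
-- before the next true.
Gaps : Set
Gaps = Bool × List Bool

gaps : List Bool → Gaps
gaps []          = false , []
gaps (true ∷ w)  = false , proj₁ (gaps w) ∷ proj₂ (gaps w)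
gaps (false ∷ w) = true , proj₂ (gaps w)

_⊑_ : Gaps → Gaps → Set
_⊑_ = ×-Pointwise _≤_ (Pointwise _≤_)

⊑-refl : ∀ g → g ⊑ g
⊑-refl _ = Bool.≤-refl , Pointwise.refl Bool.≤-refl

⊑-trans : ∀ {g h k} → g ⊑ h → h ⊑ k → g ⊑ k
⊑-trans (b≤c , bs≤cs) (c≤d , cs≤ds) =
  Bool.≤-trans b≤c c≤d , Pointwise.transitive Bool.≤-trans bs≤cs cs≤ds

⊑-antisym : ∀ {g h} → g ⊑ h → h ⊑ g → g ≡ h
⊑-antisym (b≤c , bs≤cs) (c≤b , cs≤bs) =
  cong₂ _,_ (Bool.≤-antisym b≤c c≤b) (Pointwise-≡⇒≡ (antisymmetric Bool.≤-antisym bs≤cs cs≤bs))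

gaps-++-trueless : ∀ x w → trues x ≡ 0 → gaps (x ++ w) ⊑ (true , proj₂ (gaps w))
gaps-++-trueless []          w _ = Bool.≤-maximum _ , Pointwise.refl Bool.≤-refl
gaps-++-trueless (false ∷ x) w e = b≤b , proj₂ (gaps-++-trueless x w e)

-- A false in p may match any factor other than a single true; once p accounts for every
-- true of w, each such factor is true-free and so only fills the gap it sits in.
Concat-Mark⇒gaps-⊑ : ∀ {p w} → Concat Mark p w → trues w ≤ℕ trues p → gaps w ⊑ gaps p
Concat-Mark⇒gaps-⊑ []                   _ = ⊑-refl _
Concat-Mark⇒gaps-⊑ (_∷_ {true} refl xs) (s≤s ws≤p)
  with b≤c , bs≤cs ← Concat-Mark⇒gaps-⊑ xs ws≤p = b≤b , b≤c ∷ bs≤cs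
Concat-Mark⇒gaps-⊑ (_∷_ {false} {as = p} {w = x} {ws} _ xs) x++ws≤p =
  ⊑-trans (gaps-++-trueless x ws x-trueless) (b≤b , proj₂ (Concat-Mark⇒gaps-⊑ xs ws≤p))
  where
    x+ws≤p : trues x + trues ws ≤ℕ trues p
    x+ws≤p = subst (_≤ℕ trues p) (trues-++ x ws) x++ws≤p
    ws≤p : trues ws ≤ℕ trues p
    ws≤p = ≤-trans (m≤n+m (trues ws) (trues x)) x+ws≤p
    x-trueless : trues x ≡ 0
    x-trueless = n≤0⇒n≡0 (+-cancelʳ-≤ (trues ws) (trues x) 0
                   (≤-trans x+ws≤p (Concat-Mark⇒trues-≤ xs)))

Concat-Mark-mutual⇒gaps-≡ : ∀ {p q} → Concat Mark p q → Concat Mark q p → gaps p ≡ gaps q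
Concat-Mark-mutual⇒gaps-≡ p∋q q∋p =
  ⊑-antisym (Concat-Mark⇒gaps-⊑ q∋p (Concat-Mark⇒trues-≤ p∋q))
            (Concat-Mark⇒gaps-⊑ p∋q (Concat-Mark⇒trues-≤ q∋p))

-- Both leading bits are determined by the first letter, which each profile determines.
gaps-≡⇒leading-gap-not-≡ : ∀ p q → gaps p ≡ gaps q →
  proj₁ (gaps (map not p)) ≡ proj₁ (gaps (map not q))
gaps-≡⇒leading-gap-not-≡ []          []          _  = refl
gaps-≡⇒leading-gap-not-≡ (true ∷ _)  (true ∷ _)  _  = refl
gaps-≡⇒leading-gap-not-≡ (false ∷ _) (false ∷ _) _  = refl
gaps-≡⇒leading-gap-not-≡ []          (true ∷ _)  ()
gaps-≡⇒leading-gap-not-≡ []          (false ∷ _) ()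
gaps-≡⇒leading-gap-not-≡ (true ∷ _)  []          ()
gaps-≡⇒leading-gap-not-≡ (true ∷ _)  (false ∷ _) ()
gaps-≡⇒leading-gap-not-≡ (false ∷ _) []          ()
gaps-≡⇒leading-gap-not-≡ (false ∷ _) (true ∷ _)  ()

gaps-not-≡⇒leading-gap-≡ : ∀ p q → gaps (map not p) ≡ gaps (map not q) →
  proj₁ (gaps p) ≡ proj₁ (gaps q)
gaps-not-≡⇒leading-gap-≡ []          []          _  = refl
gaps-not-≡⇒leading-gap-≡ (true ∷ _)  (true ∷ _)  _  = refl
gaps-not-≡⇒leading-gap-≡ (false ∷ _) (false ∷ _) _  = refl
gaps-not-≡⇒leading-gap-≡ []          (true ∷ _)  ()
gaps-not-≡⇒leading-gap-≡ []          (false ∷ _) ()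
gaps-not-≡⇒leading-gap-≡ (true ∷ _)  []          ()
gaps-not-≡⇒leading-gap-≡ (true ∷ _)  (false ∷ _) ()
gaps-not-≡⇒leading-gap-≡ (false ∷ _) []          ()
gaps-not-≡⇒leading-gap-≡ (false ∷ _) (true ∷ _)  ()

gaps-injective : ∀ p q → gaps p ≡ gaps q → gaps (map not p) ≡ gaps (map not q) → p ≡ q
gaps-injective []          []          _  _  = refl
gaps-injective (true ∷ p)  (true ∷ q)  e  e′ = cong (true ∷_) (gaps-injective p q gaps≡ gaps-not≡)
  where
    gaps≡ : gaps p ≡ gaps q
    gaps≡ = uncurry (cong₂ _,_) (∷-injective (cong proj₂ e))
    gaps-not≡ : gaps (map not p) ≡ gaps (map not q)
    gaps-not≡ = cong₂ _,_ (gaps-≡⇒leading-gap-not-≡ p q gaps≡) (cong proj₂ e′)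
gaps-injective (false ∷ p) (false ∷ q) e  e′ = cong (false ∷_) (gaps-injective p q gaps≡ gaps-not≡)
  where
    gaps-not≡ : gaps (map not p) ≡ gaps (map not q)
    gaps-not≡ = uncurry (cong₂ _,_) (∷-injective (cong proj₂ e′))
    gaps≡ : gaps p ≡ gaps q
    gaps≡ = cong₂ _,_ (gaps-not-≡⇒leading-gap-≡ p q gaps-not≡) (cong proj₂ e)
gaps-injective []          (true ∷ _)  ()
gaps-injective []          (false ∷ _) ()
gaps-injective (true ∷ _)  []          ()
gaps-injective (true ∷ _)  (false ∷ _) ()
gaps-injective (false ∷ _) []          ()
gaps-injective (false ∷ _) (true ∷ _)  ()

marking : {V : Set} → Bool → Valuation V Bool
marking b _ = Mark b

-- Under marking b the letter l denotes Mark (sign b l), up to double negation.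
sign : Bool → Lit → Bool
sign b zl  = b
sign b z⁻l = not b

marks : Bool → List Lit → List Bool
marks b = map (sign b)

litTerm-marking⇒Mark : {V : Set} (z : V) (b : Bool) →
  ∀ l {w} → ⟦ litTerm z l ⟧ (marking b) w → Mark (sign b l) w
litTerm-marking⇒Mark z b     zl  x = x
litTerm-marking⇒Mark z true  z⁻l x = x
litTerm-marking⇒Mark z false z⁻l x = decidable-stable (≡-dec Bool._≟_ _ _) x

Mark⇒litTerm-marking : {V : Set} (z : V) (b : Bool) →
  ∀ l {w} → Mark (sign b l) w → ⟦ litTerm z l ⟧ (marking b) w
Mark⇒litTerm-marking z b     zl  x = x
Mark⇒litTerm-marking z true  z⁻l x = x
Mark⇒litTerm-marking z false z⁻l x = λ ¬x → ¬x x

module _ {V : Set} (z : V) (b : Bool) where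

  wordTerm-marking⇒Concat : ∀ u {w} → ⟦ wordTerm z u ⟧ (marking b) w → Concat Mark (marks b u) w
  wordTerm-marking⇒Concat u = Concat-map⁺ (litTerm-marking⇒Mark z b) ∘ wordTerm⇒Concat z (marking b) u

  Concat⇒wordTerm-marking : ∀ u {w} → Concat Mark (marks b u) w → ⟦ wordTerm z u ⟧ (marking b) w
  Concat⇒wordTerm-marking u = Concat⇒wordTerm z (marking b) u ∘ Concat-map⁻ (Mark⇒litTerm-marking z b) u

  wordTerm-marking-marks : ∀ u → ⟦ wordTerm z u ⟧ (marking b) (marks b u)
  wordTerm-marking-marks u = Concat⇒wordTerm-marking u (Mark-self (marks b u))

  marking-≐⇒gaps-≡ : ∀ u v → ⟦ wordTerm z u ⟧ (marking b) ≐ ⟦ wordTerm z v ⟧ (marking b) →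
    gaps (marks b u) ≡ gaps (marks b v)
  marking-≐⇒gaps-≡ u v u≐v = Concat-Mark-mutual⇒gaps-≡
    (wordTerm-marking⇒Concat u (proj₂ (u≐v _) (wordTerm-marking-marks v)))
    (wordTerm-marking⇒Concat v (proj₁ (u≐v _) (wordTerm-marking-marks u)))

sign-true-injective : ∀ {l l′} → sign true l ≡ sign true l′ → l ≡ l′
sign-true-injective {zl}  {zl}  _ = refl
sign-true-injective {z⁻l} {z⁻l} _ = refl
sign-true-injective {zl}  {z⁻l} ()
sign-true-injective {z⁻l} {zl}  ()

map-not-marks-true : ∀ u → map not (marks true u) ≡ marks false u
map-not-marks-true u = trans (sym (map-∘ u)) (map-cong (λ { zl → refl ; z⁻l → refl }) u)

marks-gaps-injective : ∀ u v → (∀ b → gaps (marks b u) ≡ gaps (marks b v)) → u ≡ v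
marks-gaps-injective u v gaps≡ = map-injective sign-true-injective
  (gaps-injective (marks true u) (marks true v) (gaps≡ true) gaps-not≡)
  where
    gaps-not≡ : gaps (map not (marks true u)) ≡ gaps (map not (marks true v))
    gaps-not≡ rewrite map-not-marks-true u | map-not-marks-true v = gaps≡ false

Bool≤2 : CardLe Bool 2
Bool≤2 = Injection.to Bool↣Fin2 , Injection.injective Bool↣Fin2
  where
    Bool↣Fin2 : Bool ↣ Fin 2
    Bool↣Fin2 = ↔⇒↣ (↔-sym 2↔Bool)

LANG[2]⊨-wordTerm⇒≡ : {V : Set} (z : V) (u v : List Lit) →
  LANG[ 2 ]⊨ (wordTerm z u) (wordTerm z v) → u ≡ v
LANG[2]⊨-wordTerm⇒≡ z u v H =
  marks-gaps-injective u v (λ b → marking-≐⇒gaps-≡ z b u v (H Bool Bool≤2 (marking b)))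

LANG⊨⇒LANG[n]⊨ : ∀ {V} n (t s : Term V) → LANG⊨ t s → LANG[ n ]⊨ t s
LANG⊨⇒LANG[n]⊨ _ _ _ H X _ = H X

LANG⊨-refl : ∀ {V} (t : Term V) → LANG⊨ t t
LANG⊨-refl _ _ _ _ = (λ x → x) , (λ x → x)

theorem6p6 : {V : Set} (z : V) (u v : List Lit) →
    (LANG[ 2 ]⊨ (wordTerm z u) (wordTerm z v) ⇔ LANG⊨ (wordTerm z u) (wordTerm z v))
    × (LANG⊨ (wordTerm z u) (wordTerm z v) ⇔ (u ≡ v))
theorem6p6 z u v =
  mk⇔ (≡⇒LANG⊨ ∘ LANG[2]⊨-wordTerm⇒≡ z u v) (LANG⊨⇒LANG[n]⊨ 2 (wordTerm z u) (wordTerm z v)) ,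
  mk⇔ (LANG[2]⊨-wordTerm⇒≡ z u v ∘ LANG⊨⇒LANG[n]⊨ 2 (wordTerm z u) (wordTerm z v)) ≡⇒LANG⊨
  where
    ≡⇒LANG⊨ : u ≡ v → LANG⊨ (wordTerm z u) (wordTerm z v)
    ≡⇒LANG⊨ refl = LANG⊨-refl (wordTerm z u)
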